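{- ${\sf ITL}^0_{{\circ}\forall}$ is complete for the class of expanding posets and ${\sf ITL}^{\sf FS}_{{\circ}\forall}$ is complete for the class of persistent posets: every formula of $\mathcal L_{\forall}$ valid on all expanding posets is derivable in ${\sf ITL}^0_{{\circ}\forall}$, and every formula of $\mathcal L_\forall$ valid on all persistent posets is derivable in ${\sf ITL}^{\sf FS}_{{\circ}\forall}$.
   Context: Fix a countably infinite set $\mathbb P$ of propositional variables. $\mathcal L_{\forall}$ is given by $\varphi::=\bot\mid p\mid \varphi\wedge\varphi\mid\varphi\vee\varphi\mid\varphi\to\varphi\mid{\circ}\varphi\mid\forall\varphi$; $\neg\varphi:=\varphi\to\bot$. A dynamical system is $(X,\mathcal T,f)$ with $f:X\to X$ continuous; a valuation assigns open sets to formulas with $[\![\bot]\!]=\varnothing$, $[\![p]\!]$ any open set, $\wedge,\vee$ as intersection/union, $[\![\varphi\to\psi]\!]$ = interior of $(X\setminus[\![\varphi]\!])\cup[\![\psi]\!]$, $[\![{\circ}\varphi]\!]=f^{ -1}[\![\varphi]\!]$, $[\![\forall\varphi]\!]=X$ if $[\![\varphi]\!]=X$ and $\varnothing$ otherwise. Validity on a system: $[\![\varphi]\!]=X$ for all valuations. An expanding poset is a dynamical system whose topology is the up-set topology of a partial order $\preccurlyeq$ (so $f$ is monotone); a persistent poset is an expanding poset where moreover whenever $f(w)\preccurlyeq v'$ there is $w'\succcurlyeq w$ with $f(w')=v'$. ${\sf ITL}^0_{{\circ}\forall}$ is the least set of $\mathcal L_\forall$-formulas containing all substitution instances of the axioms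 of intuitionistic propositional logic and of: $\neg{\circ}\bot$; ${\circ}\varphi\wedge{\circ}\psi\to{\circ}(\varphi\wedge\psi)$; ${\circ}(\varphi\vee\psi)\to{\circ}\varphi\vee{\circ}\psi$; ${\circ}(\varphi\to\psi)\to({\circ}\varphi\to{\circ}\psi)$; $\forall\varphi\vee\neg\forall\varphi$; $\forall(\varphi\to\psi)\to(\forall\varphi\to\forall\psi)$; $\forall(\varphi\vee\forall\psi)\to\forall\varphi\vee\forall\psi$; $\forall\varphi\to\varphi$; $\forall\varphi\to\forall\forall\varphi$; $\forall\varphi\leftrightarrow{\circ}\forall\varphi$; and closed under modus ponens, from $\varphi$ infer ${\circ}\varphi$, and from $\varphi$ infer $\forall\varphi$. ${\sf ITL}^{\sf FS}_{{\circ}\forall}$ is obtained by additionally adding all instances of $({\circ}\varphi\to{\circ}\psi)\to{\circ}(\varphi\to\psi)$. -}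

module Defs where

open import Data.Nat using (ℕ)
open import Data.Empty using (⊥)
open import Data.Product using (_×_; Σ; ∃; _,_)
open import Data.Sum using (_⊎_)
open import Relation.Binary.PropositionalEquality using (_≡_)
open import Relation.Binary.Structures using (IsPartialOrder)

infixr 6 _∧'_
infixr 5 _∨'_
infixr 4 _⇒_

data Form : Set where
  ⊥'   : Form
  var  : ℕ → Form
  _∧'_ : Form → Form → Form
  _∨'_ : Form → Form → Form
  _⇒_  : Form → Form → Form
  ○    : Form → Form
  A    : Form → Form

¬' : Form → Form
¬' φ = φ ⇒ ⊥'

_⇔'_ : Form → Form → Form
φ ⇔' ψ = (φ ⇒ ψ) ∧' (ψ ⇒ φ)

data IPCAx : Form → Set where
  k     : ∀ φ ψ → IPCAx (φ ⇒ ψ ⇒ φ)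
  s     : ∀ φ ψ χ → IPCAx ((φ ⇒ ψ ⇒ χ) ⇒ (φ ⇒ ψ) ⇒ φ ⇒ χ)
  ∧e₁   : ∀ φ ψ → IPCAx (φ ∧' ψ ⇒ φ)
  ∧e₂   : ∀ φ ψ → IPCAx (φ ∧' ψ ⇒ ψ)
  ∧i    : ∀ φ ψ → IPCAx (φ ⇒ ψ ⇒ φ ∧' ψ)
  ∨i₁   : ∀ φ ψ → IPCAx (φ ⇒ φ ∨' ψ)
  ∨i₂   : ∀ φ ψ → IPCAx (ψ ⇒ φ ∨' ψ)
  ∨e    : ∀ φ ψ χ → IPCAx ((φ ⇒ χ) ⇒ (ψ ⇒ χ) ⇒ φ ∨' ψ ⇒ χ)
  efq   : ∀ φ → IPCAx (⊥' ⇒ φ)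

data ModalAx : Form → Set where
  nxt⊥    : ModalAx (¬' (○ ⊥'))
  nxt∧    : ∀ φ ψ → ModalAx (○ φ ∧' ○ ψ ⇒ ○ (φ ∧' ψ))
  nxt∨    : ∀ φ ψ → ModalAx (○ (φ ∨' ψ) ⇒ ○ φ ∨' ○ ψ)
  nxtK    : ∀ φ ψ → ModalAx (○ (φ ⇒ ψ) ⇒ (○ φ ⇒ ○ ψ))
  allLEM  : ∀ φ → ModalAx (A φ ∨' ¬' (A φ))
  allK    : ∀ φ ψ → ModalAx (A (φ ⇒ ψ) ⇒ (A φ ⇒ A ψ))
  allCD   : ∀ φ ψ → ModalAx (A (φ ∨' A ψ) ⇒ A φ ∨' A ψ)
  allT    : ∀ φ → ModalAx (A φ ⇒ φ)
  all4    : ∀ φ → ModalAx (A φ ⇒ A (A φ))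
  allNxt  : ∀ φ → ModalAx (A φ ⇔' ○ (A φ))

data FSAx : Form → Set where
  fs : ∀ φ ψ → FSAx ((○ φ ⇒ ○ ψ) ⇒ ○ (φ ⇒ ψ))

data ⊢⁰ : Form → Set where
  ipc  : ∀ {φ} → IPCAx φ → ⊢⁰ φ
  ax   : ∀ {φ} → ModalAx φ → ⊢⁰ φ
  mp   : ∀ {φ ψ} → ⊢⁰ (φ ⇒ ψ) → ⊢⁰ φ → ⊢⁰ ψ
  nec○ : ∀ {φ} → ⊢⁰ φ → ⊢⁰ (○ φ)
  nec∀ : ∀ {φ} → ⊢⁰ φ → ⊢⁰ (A φ)

data ⊢FS : Form → Set where
  ipc  : ∀ {φ} → IPCAx φ → ⊢FS φ
  ax   : ∀ {φ} → ModalAx φ → ⊢FS φ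
  axFS : ∀ {φ} → FSAx φ → ⊢FS φ
  mp   : ∀ {φ ψ} → ⊢FS (φ ⇒ ψ) → ⊢FS φ → ⊢FS ψ
  nec○ : ∀ {φ} → ⊢FS φ → ⊢FS (○ φ)
  nec∀ : ∀ {φ} → ⊢FS φ → ⊢FS (A φ)

record ExpandingPoset : Set₁ where
  field
    W          : Set
    _≼_        : W → W → Set
    isPartialOrder : IsPartialOrder _≡_ _≼_
    f          : W → W
    monotone   : ∀ {w v} → w ≼ v → f w ≼ f v

record PersistentPoset : Set₁ where
  field
    expanding : ExpandingPoset
  open ExpandingPoset expanding
  field
    persistent : ∀ w v' → f w ≼ v' → Σ W (λ w' → (w ≼ w') × (f w' ≡ v'))

module _ (M : ExpandingPoset) where
  open ExpandingPoset M

  UpSet : (W → Set) → Set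
  UpSet U = ∀ {w v} → w ≼ v → U w → U v

  record Valuation : Set₁ where
    field
      V      : ℕ → W → Set
      V-open : ∀ p → UpSet (V p)

  -- ⟦ φ ⟧ w  means  w ∈ [[φ]].
  -- In the up-set topology, the interior of (X ∖ [[φ]]) ∪ [[ψ]] is
  -- { w | ∀ v ≽ w, v ∈ [[φ]] → v ∈ [[ψ]] };
  -- [[∀φ]] is X if [[φ]] = X and ∅ otherwise, i.e. w ∈ [[∀φ]] iff ∀ v, v ∈ [[φ]].
  ⟦_⟧ : Form → Valuation → W → Set
  ⟦ ⊥' ⟧    ν w = ⊥
  ⟦ var p ⟧ ν w = Valuation.V ν p w
  ⟦ φ ∧' ψ ⟧ ν w = ⟦ φ ⟧ ν w × ⟦ ψ ⟧ ν w
  ⟦ φ ∨' ψ ⟧ ν w = ⟦ φ ⟧ ν w ⊎ ⟦ ψ ⟧ ν w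
  ⟦ φ ⇒ ψ ⟧ ν w = ∀ v → w ≼ v → ⟦ φ ⟧ ν v → ⟦ ψ ⟧ ν v
  ⟦ ○ φ ⟧   ν w = ⟦ φ ⟧ ν (f w)
  ⟦ A φ ⟧   ν w = ∀ v → ⟦ φ ⟧ ν v

  ValidOn : Form → Set₁
  ValidOn φ = ∀ (ν : Valuation) (w : W) → ⟦ φ ⟧ ν w

ValidExpanding : Form → Set₁
ValidExpanding φ = ∀ (M : ExpandingPoset) → ValidOn M φ

ValidPersistent : Form → Set₁
ValidPersistent φ = ∀ (M : PersistentPoset) → ValidOn (PersistentPoset.expanding M) φ

-- A canonical model argument. Prime theories are obtained by a Lindenbaum
-- construction along a stagewise enumeration of the formulas, excluded middle
-- deciding at each step on which side a formula goes. A world is an orbit: a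
-- sequence of prime theories Θ₀, Θ₁, … with φ ∈ Θₙ₊₁ iff ○φ ∈ Θₙ, all sharing
-- their ∀-formulas with one prime theory g that refutes the given formula; f is
-- the shift. The axioms ∀φ ∨ ¬∀φ and ∀φ ↔ ○∀φ keep this ∀-part fixed under
-- extension and under shifting, which is what makes ∀ the global modality, and
-- the witnesses the truth lemma needs for ⇒ and ∀ come from Lindenbaum again.
-- With Fischer Servi the model is also persistent: if Θ₀(w) ∪ ○Θ₀(v) could not be
-- extended avoiding every ○φ with φ ∉ Θ₀(v), then Γ, ○⋀C ⊢ ○⋁D for some Γ ⊆ Θ₀(w),
-- C ⊆ Θ₀(v) and D disjoint from Θ₀(v); Fischer Servi puts ○(⋀C → ⋁D) into Θ₀(w),
-- hence ⋀C → ⋁D into Θ₁(w) ⊆ Θ₀(v), so Θ₀(v) would meet D.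

module Submission where

open import Defs
open import Axiom.ExcludedMiddle using (ExcludedMiddle)
open import Level using (0ℓ)
open import Data.Bool using (Bool; true; _≟_)
open import Data.Bool.Properties using (⇔→≡; T-≡)
open import Data.Empty using (⊥; ⊥-elim)
open import Data.List using (List; []; _∷_; _++_; map; concatMap; cartesianProductWith)
open import Data.List.Membership.Propositional using (_∈_)
open import Data.List.Membership.Propositional.Properties
  using (∈-++⁺ˡ; ∈-++⁺ʳ; ∈-++⁻; ∈-map⁺; ∈-map⁻; ∈-concatMap⁺; ∈-cartesianProductWith⁺)
open import Data.List.Relation.Binary.Subset.Propositional using (_⊆_)
open import Data.List.Relation.Binary.Subset.Propositional.Properties
  using (⊆-trans; xs⊆x∷xs; xs⊆xs++ys; xs⊆ys++xs; ∷⁺ʳ; ∈-∷⁺ʳ; ++⁺ʳ)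
open import Data.List.Relation.Unary.All as All using (All; []; _∷_)
open import Data.List.Relation.Unary.All.Properties as All using () renaming (++⁺ to All++⁺)
open import Data.List.Relation.Unary.Any as Any using (here; there)
open import Data.Nat using (ℕ; zero; suc; _≤_; _≤′_; ≤′-reflexive; ≤′-step; _⊔_)
open import Data.Nat.GeneralisedArithmetic using (fold)
open import Data.Nat.Properties using (≤⇒≤′; m≤m⊔n; m≤n⊔m; <-irrefl; ≤-refl; ≤-trans; n≤1+n)
open import Data.Product using (∃; ∃₂; _×_; _,_; proj₁; proj₂)
open import Data.Sum using (_⊎_; inj₁; inj₂; [_,_])
open import Function using (_∘_; id; mk⇔; Equivalence)
open import Relation.Binary.PropositionalEquality
  using (_≡_; refl; sym; trans; subst; isEquivalence)
open import Relation.Nullary using (¬_; yes; no)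
open import Relation.Nullary.Decidable using (isYes; toWitness; fromWitness)
open import Relation.Unary using (Pred; _∪_; ｛_｝; ∅; ∁) renaming (_⊆_ to _⊆ᵖ_)

variable
  m n : ℕ
  φ ψ χ : Form
  Γ Δ Δ′ : List Form
  Φ Ψ : Pred Form 0ℓ

record Logic : Set₁ where
  infix 3 ⊢_
  field
    ⊢_     : Form → Set
    ⊢-ipc  : ∀ {φ} → IPCAx φ → ⊢ φ
    ⊢-ax   : ∀ {φ} → ModalAx φ → ⊢ φ
    ⊢-mp   : ∀ {φ ψ} → ⊢ φ ⇒ ψ → ⊢ φ → ⊢ ψ
    ⊢-nec○ : ∀ {φ} → ⊢ φ → ⊢ ○ φ
    ⊢-nec∀ : ∀ {φ} → ⊢ φ → ⊢ A φ

ITL⁰ : Logic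
ITL⁰ = record { ⊢_ = ⊢⁰ ; ⊢-ipc = ipc ; ⊢-ax = ax ; ⊢-mp = mp ; ⊢-nec○ = nec○ ; ⊢-nec∀ = nec∀ }

ITLFS : Logic
ITLFS = record { ⊢_ = ⊢FS ; ⊢-ipc = ipc ; ⊢-ax = ax ; ⊢-mp = mp ; ⊢-nec○ = nec○ ; ⊢-nec∀ = nec∀ }

FischerServi : Logic → Set
FischerServi L = ∀ φ ψ → ⊢ (○ φ ⇒ ○ ψ) ⇒ ○ (φ ⇒ ψ)
  where open Logic L

ITLFS-FischerServi : FischerServi ITLFS
ITLFS-FischerServi φ ψ = axFS (fs φ ψ)

binaryConnectives : List (Form → Form → Form)
binaryConnectives = _∧'_ ∷ _∨'_ ∷ _⇒_ ∷ []

formulas : ℕ → List Form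
formulas zero    = ⊥' ∷ []
formulas (suc n) = Fs ++ var n ∷ map ○ Fs ++ map A Fs
                      ++ concatMap (λ _∙_ → cartesianProductWith _∙_ Fs Fs) binaryConnectives
  where Fs = formulas n

formulas-mono : m ≤ n → formulas m ⊆ formulas n
formulas-mono = go ∘ ≤⇒≤′
  where
  go : m ≤′ n → formulas m ⊆ formulas n
  go (≤′-reflexive refl) = id
  go (≤′-step p)         = ∈-++⁺ˡ ∘ go p

○∈formulas : φ ∈ formulas n → ○ φ ∈ formulas (suc n)
○∈formulas {n = n} i = ∈-++⁺ʳ (formulas n) (there (∈-++⁺ˡ (∈-map⁺ ○ i)))

A∈formulas : φ ∈ formulas n → A φ ∈ formulas (suc n)
A∈formulas {n = n} i =
  ∈-++⁺ʳ (formulas n) (there (∈-++⁺ʳ (map ○ (formulas n)) (∈-++⁺ˡ (∈-map⁺ A i))))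

binary∈formulas : ∀ {_∙_} → _∙_ ∈ binaryConnectives →
                  ∃ (λ m → φ ∈ formulas m) → ∃ (λ n → ψ ∈ formulas n) →
                  ∃ λ k → φ ∙ ψ ∈ formulas k
binary∈formulas {_∙_ = _∙_} c (m , i) (n , j) =
  suc (m ⊔ n) ,
  ∈-++⁺ʳ Fs (there (∈-++⁺ʳ (map ○ Fs) (∈-++⁺ʳ (map A Fs)
    (∈-concatMap⁺ products (Any.map (λ { refl → ∈-cartesianProductWith⁺ _∙_ i′ j′ }) c)))))
  where
  Fs = formulas (m ⊔ n)

  products : (Form → Form → Form) → List Form
  products _•_ = cartesianProductWith _•_ Fs Fs
  i′ = formulas-mono (m≤m⊔n m n) i
  j′ = formulas-mono (m≤n⊔m m n) j

formulas-cover : ∀ φ → ∃ λ n → φ ∈ formulas n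
formulas-cover ⊥'       = 0 , here refl
formulas-cover (var p)  = suc p , ∈-++⁺ʳ (formulas p) (here refl)
formulas-cover (○ φ)    = let n , i = formulas-cover φ in suc n , ○∈formulas i
formulas-cover (A φ)    = let n , i = formulas-cover φ in suc n , A∈formulas i
formulas-cover (φ ∧' ψ) = binary∈formulas (here refl)                 (formulas-cover φ) (formulas-cover ψ)
formulas-cover (φ ∨' ψ) = binary∈formulas (there (here refl))         (formulas-cover φ) (formulas-cover ψ)
formulas-cover (φ ⇒ ψ)  = binary∈formulas (there (there (here refl))) (formulas-cover φ) (formulas-cover ψ)

All-∪ : ∀ {P Q : Pred Form 0ℓ} → All (P ∪ Q) Γ →
        ∃₂ λ Γ₁ Γ₂ → All P Γ₁ × All Q Γ₂ × Γ ⊆ Γ₁ ++ Γ₂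
All-∪ [] = [] , [] , [] , [] , λ ()
All-∪ {Γ = φ ∷ _} (inj₁ p ∷ ps) with Γ₁ , Γ₂ , ps₁ , qs₂ , Γ⊆ ← All-∪ ps =
  φ ∷ Γ₁ , Γ₂ , p ∷ ps₁ , qs₂ , ∷⁺ʳ φ Γ⊆
All-∪ {Γ = φ ∷ _} (inj₂ q ∷ ps) with Γ₁ , Γ₂ , ps₁ , qs₂ , Γ⊆ ← All-∪ ps =
  Γ₁ , φ ∷ Γ₂ , ps₁ , q ∷ qs₂ , ∈-∷⁺ʳ (∈-++⁺ʳ Γ₁ (here refl)) (⊆-trans Γ⊆ (++⁺ʳ Γ₁ (xs⊆x∷xs Γ₂ φ)))

All-∪｛｝ : ∀ {P : Pred Form 0ℓ} → All (P ∪ ｛ χ ｝) Γ → ∃ λ Γ′ → All P Γ′ × Γ ⊆ χ ∷ Γ′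
All-∪｛｝ ps with Γ₁ , Γ₂ , ps₁ , χs , Γ⊆ ← All-∪ ps =
  Γ₁ , ps₁ , λ i → [ there , (λ j → here (sym (All.lookup χs j))) ] (∈-++⁻ Γ₁ (Γ⊆ i))

○[_] : Pred Form 0ℓ → Pred Form 0ℓ
○[ P ] χ = ∃ λ φ → χ ≡ ○ φ × P φ

All-○[] : ∀ {P : Pred Form 0ℓ} → All ○[ P ] Γ → ∃ λ Δ → All P Δ × map ○ Δ ≡ Γ
All-○[] [] = [] , [] , refl
All-○[] ((φ , refl , p) ∷ ps) with Δ , ps′ , refl ← All-○[] ps = φ ∷ Δ , p ∷ ps′ , refl

-- Boolean-valued, so that the canonical model has its carrier in Set.
Theory : Set
Theory = Form → Bool

infix 3 _∈ₜ_
_∈ₜ_ : Form → Theory → Set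
φ ∈ₜ t = t φ ≡ true

_⊆ₜ_ : Theory → Theory → Set
t ⊆ₜ u = ∀ {χ} → χ ∈ₜ t → χ ∈ₜ u

_≈∀_ : Theory → Theory → Set
t ≈∀ u = ∀ ψ → t (A ψ) ≡ u (A ψ)

module _ (L : Logic) where
  open Logic L

  infix 3.5 _⇛_
  _⇛_ : List Form → Form → Form
  []      ⇛ φ = φ
  (ψ ∷ Γ) ⇛ φ = Γ ⇛ ψ ⇒ φ

  ⊢-id : ⊢ φ ⇒ φ
  ⊢-id {φ} = ⊢-mp (⊢-mp (⊢-ipc (s φ (φ ⇒ φ) φ)) (⊢-ipc (k φ (φ ⇒ φ)))) (⊢-ipc (k φ φ))

  ⇛-const : ∀ Γ → ⊢ φ → ⊢ Γ ⇛ φ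
  ⇛-const []      ⊢φ = ⊢φ
  ⇛-const (ψ ∷ Γ) ⊢φ = ⇛-const Γ (⊢-mp (⊢-ipc (k _ ψ)) ⊢φ)

  ⇛-mp : ∀ Γ → ⊢ Γ ⇛ φ ⇒ ψ → ⊢ Γ ⇛ φ → ⊢ Γ ⇛ ψ
  ⇛-mp []      ⊢φ⇒ψ ⊢φ = ⊢-mp ⊢φ⇒ψ ⊢φ
  ⇛-mp (χ ∷ Γ) ⊢φ⇒ψ ⊢φ = ⇛-mp Γ (⇛-mp Γ (⇛-const Γ (⊢-ipc (s χ _ _))) ⊢φ⇒ψ) ⊢φ

  ⇛-hyp : φ ∈ Γ → ⊢ Γ ⇛ φ
  ⇛-hyp {Γ = ψ ∷ Γ} (here refl) = ⇛-const Γ ⊢-id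
  ⇛-hyp {Γ = ψ ∷ Γ} (there i)   = ⇛-mp Γ (⇛-const Γ (⊢-ipc (k _ ψ))) (⇛-hyp i)

  infix 3 _⊩_
  data _⊩_ : List Form → Form → Set where
    hyp : φ ∈ Γ → Γ ⊩ φ
    thm : ⊢ φ → Γ ⊩ φ
    app : Γ ⊩ φ ⇒ ψ → Γ ⊩ φ → Γ ⊩ ψ
    lam : φ ∷ Γ ⊩ ψ → Γ ⊩ φ ⇒ ψ

  hyp₀ : φ ∷ Γ ⊩ φ
  hyp₀ = hyp (here refl)

  hyp₁ : ψ ∷ φ ∷ Γ ⊩ φ
  hyp₁ = hyp (there (here refl))

  ⊩⇒⊢⇛ : Γ ⊩ φ → ⊢ Γ ⇛ φ
  ⊩⇒⊢⇛         (hyp i)   = ⇛-hyp i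
  ⊩⇒⊢⇛ {Γ = Γ} (thm ⊢φ)  = ⇛-const Γ ⊢φ
  ⊩⇒⊢⇛ {Γ = Γ} (app d e) = ⇛-mp Γ (⊩⇒⊢⇛ d) (⊩⇒⊢⇛ e)
  ⊩⇒⊢⇛         (lam d)   = ⊩⇒⊢⇛ d

  ⊩⇒⊢ : [] ⊩ φ → ⊢ φ
  ⊩⇒⊢ = ⊩⇒⊢⇛

  ⊩-weaken : Γ ⊆ Δ → Γ ⊩ φ → Δ ⊩ φ
  ⊩-weaken Γ⊆Δ (hyp i)   = hyp (Γ⊆Δ i)
  ⊩-weaken Γ⊆Δ (thm ⊢φ)  = thm ⊢φ
  ⊩-weaken Γ⊆Δ (app d e) = app (⊩-weaken Γ⊆Δ d) (⊩-weaken Γ⊆Δ e)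
  ⊩-weaken Γ⊆Δ (lam d)   = lam (⊩-weaken (∷⁺ʳ _ Γ⊆Δ) d)

  ⊩-subst : (∀ {ψ} → ψ ∈ Γ → Δ ⊩ ψ) → Γ ⊩ φ → Δ ⊩ φ
  ⊩-subst σ (hyp i)   = σ i
  ⊩-subst σ (thm ⊢φ)  = thm ⊢φ
  ⊩-subst σ (app d e) = app (⊩-subst σ d) (⊩-subst σ e)
  ⊩-subst σ (lam d)   = lam (⊩-subst (λ { (here refl) → hyp₀ ; (there i) → ⊩-weaken there (σ i) }) d)

  axiom : ModalAx φ → Γ ⊩ φ
  axiom = thm ∘ ⊢-ax

  ∧I : Γ ⊩ φ → Γ ⊩ ψ → Γ ⊩ φ ∧' ψ
  ∧I d e = app (app (thm (⊢-ipc (∧i _ _))) d) e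

  ∧E₁ : Γ ⊩ φ ∧' ψ → Γ ⊩ φ
  ∧E₁ = app (thm (⊢-ipc (∧e₁ _ _)))

  ∧E₂ : Γ ⊩ φ ∧' ψ → Γ ⊩ ψ
  ∧E₂ = app (thm (⊢-ipc (∧e₂ _ _)))

  ∨I₁ : Γ ⊩ φ → Γ ⊩ φ ∨' ψ
  ∨I₁ = app (thm (⊢-ipc (∨i₁ _ _)))

  ∨I₂ : Γ ⊩ ψ → Γ ⊩ φ ∨' ψ
  ∨I₂ = app (thm (⊢-ipc (∨i₂ _ _)))

  ∨E : Γ ⊩ φ ∨' ψ → φ ∷ Γ ⊩ χ → ψ ∷ Γ ⊩ χ → Γ ⊩ χ
  ∨E d e₁ e₂ = app (app (app (thm (⊢-ipc (∨e _ _ _))) (lam e₁)) (lam e₂)) d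

  ⊥E : Γ ⊩ ⊥' → Γ ⊩ φ
  ⊥E = app (thm (⊢-ipc (efq _)))

  ⋁ : List Form → Form
  ⋁ []      = ⊥'
  ⋁ (φ ∷ Δ) = φ ∨' ⋁ Δ

  ⋀ : List Form → Form
  ⋀ []      = ⊥' ⇒ ⊥'
  ⋀ (φ ∷ Δ) = φ ∧' ⋀ Δ

  ⋁I : φ ∈ Δ → Γ ⊩ φ → Γ ⊩ ⋁ Δ
  ⋁I (here refl) d = ∨I₁ d
  ⋁I (there i)   d = ∨I₂ (⋁I i d)

  ⋁E : ∀ Δ → Γ ⊩ ⋁ Δ → (∀ {φ} → φ ∈ Δ → φ ∷ Γ ⊩ χ) → Γ ⊩ χ
  ⋁E []      d κ = ⊥E d
  ⋁E (φ ∷ Δ) d κ = ∨E d (κ (here refl)) (⋁E Δ hyp₀ (⊩-weaken (∷⁺ʳ _ there) ∘ κ ∘ there))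

  ⋁-mono : Δ ⊆ Δ′ → Γ ⊩ ⋁ Δ → Γ ⊩ ⋁ Δ′
  ⋁-mono {Δ = Δ} Δ⊆Δ′ d = ⋁E Δ d (λ i → ⋁I (Δ⊆Δ′ i) hyp₀)

  ⋁-｛｝ : All (χ ≡_) Δ → Γ ⊩ ⋁ Δ → Γ ⊩ χ
  ⋁-｛｝ {Δ = Δ} χs d = ⋁E Δ d (λ i → hyp (here (All.lookup χs i)))

  ⋀I : ∀ Δ → (∀ {φ} → φ ∈ Δ → Γ ⊩ φ) → Γ ⊩ ⋀ Δ
  ⋀I []      κ = lam hyp₀
  ⋀I (φ ∷ Δ) κ = ∧I (κ (here refl)) (⋀I Δ (κ ∘ there))

  ⋀E : φ ∈ Δ → Γ ⊩ ⋀ Δ → Γ ⊩ φ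
  ⋀E (here refl) d = ∧E₁ d
  ⋀E (there i)   d = ⋀E i (∧E₂ d)

  infix 4 _⊩⋁_
  _⊩⋁_ : Pred Form 0ℓ → Pred Form 0ℓ → Set
  Φ ⊩⋁ Ψ = ∃₂ λ Γ Δ → All Φ Γ × All Ψ Δ × Γ ⊩ ⋁ Δ

  ⊩⋁-cut : Φ ⊩⋁ Ψ ∪ ｛ χ ｝ → Φ ∪ ｛ χ ｝ ⊩⋁ Ψ → Φ ⊩⋁ Ψ
  ⊩⋁-cut {χ = χ} (Γ , Δ , Φs , Ψχs , d) (Γ′ , Δ′ , Φχs , Ψs , d′)
    with Δ₀ , Ψs₀ , Δ⊆ ← All-∪｛｝ Ψχs | Γ₀ , Φs₀ , Γ′⊆ ← All-∪｛｝ Φχs =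
    Γ ++ Γ₀ , Δ₀ ++ Δ′ , All++⁺ Φs Φs₀ , All++⁺ Ψs₀ Ψs ,
    ∨E (⊩-weaken (xs⊆xs++ys Γ Γ₀) (⋁-mono Δ⊆ d))
       (⋁-mono (xs⊆ys++xs Δ′ Δ₀) (⊩-weaken (⊆-trans Γ′⊆ (∷⁺ʳ χ (xs⊆ys++xs Γ₀ Γ))) d′))
       (⋁-mono (xs⊆xs++ys Δ₀ Δ′) hyp₀)

  ⊩⋁-｛｝ : Φ ⊩⋁ ｛ ψ ｝ → ∃ λ Γ → All Φ Γ × Γ ⊩ ψ
  ⊩⋁-｛｝ (Γ , Δ , Φs , ψs , d) = Γ , Φs , ⋁-｛｝ ψs d

  ○-⇛ : ∀ Γ → ⊢ ○ (Γ ⇛ φ) → map ○ Γ ⊩ ○ φ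
  ○-⇛ []      ⊢○φ = thm ⊢○φ
  ○-⇛ (ψ ∷ Γ) ⊢○φ = app (app (axiom (nxtK ψ _)) (⊩-weaken there (○-⇛ Γ ⊢○φ))) hyp₀

  ⊩-○ : Γ ⊩ φ → map ○ Γ ⊩ ○ φ
  ⊩-○ {Γ = Γ} d = ○-⇛ Γ (⊢-nec○ (⊩⇒⊢⇛ d))

  ○-mono : φ ∷ [] ⊩ ψ → ○ φ ∷ Γ ⊩ ○ ψ
  ○-mono d = ⊩-weaken (λ { (here refl) → here refl }) (⊩-○ d)

  Stable : Pred Form 0ℓ
  Stable φ = ⊢ φ ⇒ A φ

  A-⇛ : ∀ Γ → All Stable Γ → ⊢ A (Γ ⇛ φ) → Γ ⊩ A φ
  A-⇛ []      []          ⊢Aφ = thm ⊢Aφ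
  A-⇛ (ψ ∷ Γ) (ψ↑ ∷ Γ↑) ⊢Aφ =
    app (app (axiom (allK ψ _)) (⊩-weaken there (A-⇛ Γ Γ↑ ⊢Aφ))) (app (thm ψ↑) hyp₀)

  ⊩-nec∀ : All Stable Γ → Γ ⊩ φ → Γ ⊩ A φ
  ⊩-nec∀ {Γ = Γ} Γ↑ d = A-⇛ Γ Γ↑ (⊢-nec∀ (⊩⇒⊢⇛ d))

  A-stable : Stable (A ψ)
  A-stable {ψ} = ⊢-ax (all4 ψ)

  ¬A-stable : Stable (¬' (A ψ))
  ¬A-stable {ψ} =
    ⊩⇒⊢ (lam (∨E (app (axiom (allCD _ ψ)) (thm (⊢-nec∀ (⊩⇒⊢ ¬A∨A)))) hyp₀ (⊥E (app hyp₁ hyp₀))))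
    where
    ¬A∨A : [] ⊩ ¬' (A ψ) ∨' A ψ
    ¬A∨A = ∨E (axiom (allLEM ψ)) (∨I₂ hyp₀) (∨I₁ hyp₀)

  record IsPrime (t : Theory) : Set where
    field
      closed     : All (_∈ₜ t) Γ → Γ ⊩ φ → φ ∈ₜ t
      consistent : ¬ (⊥' ∈ₜ t)
      prime      : φ ∨' ψ ∈ₜ t → φ ∈ₜ t ⊎ ψ ∈ₜ t

    ∈-⊩ : [] ⊩ φ → φ ∈ₜ t
    ∈-⊩ = closed []

    ∈-mp : φ ⇒ ψ ∈ₜ t → φ ∈ₜ t → ψ ∈ₜ t
    ∈-mp φ⇒ψ∈ φ∈ = closed (φ⇒ψ∈ ∷ φ∈ ∷ []) (app hyp₀ hyp₁)

    ⋁-prime : ∀ Δ → ⋁ Δ ∈ₜ t → ∃ λ φ → φ ∈ Δ × φ ∈ₜ t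
    ⋁-prime []      ⋁∈ = ⊥-elim (consistent ⋁∈)
    ⋁-prime (φ ∷ Δ) ⋁∈ with prime ⋁∈
    ... | inj₁ φ∈ = φ , here refl , φ∈
    ... | inj₂ ⋁∈′ = let ψ , i , ψ∈ = ⋁-prime Δ ⋁∈′ in ψ , there i , ψ∈

  open IsPrime

  ≈∀-of-literals : ∀ {t u} → IsPrime t → IsPrime u →
                   (∀ {ψ} → A ψ ∈ₜ t → A ψ ∈ₜ u) → (∀ {ψ} → ¬' (A ψ) ∈ₜ t → ¬' (A ψ) ∈ₜ u) →
                   u ≈∀ t
  ≈∀-of-literals {t} {u} t-prime u-prime A⊆ ¬A⊆ ψ = ⇔→≡ (mk⇔ to A⊆)
    where
    to : A ψ ∈ₜ u → A ψ ∈ₜ t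
    to A∈u with prime t-prime (∈-⊩ t-prime (axiom (allLEM ψ)))
    ... | inj₁ A∈t  = A∈t
    ... | inj₂ ¬A∈t = ⊥-elim (consistent u-prime (∈-mp u-prime (¬A⊆ ¬A∈t) A∈u))

  ≈∀-⊆ : ∀ {t u} → IsPrime t → IsPrime u → t ⊆ₜ u → u ≈∀ t
  ≈∀-⊆ t-prime u-prime t⊆u = ≈∀-of-literals t-prime u-prime t⊆u t⊆u

  next : Theory → Theory
  next t χ = t (○ χ)

  next-prime : ∀ {t} → IsPrime t → IsPrime (next t)
  next-prime t-prime = record
    { closed     = λ Γ∈ d → closed t-prime (All.map⁺ Γ∈) (⊩-○ d)
    ; consistent = λ ○⊥∈ → consistent t-prime (∈-mp t-prime (∈-⊩ t-prime (axiom nxt⊥)) ○⊥∈)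
    ; prime      = λ ○∨∈ → prime t-prime (∈-mp t-prime (∈-⊩ t-prime (axiom (nxt∨ _ _))) ○∨∈)
    }

  next-≈∀ : ∀ {t u} → IsPrime t → t ≈∀ u → next t ≈∀ u
  next-≈∀ {t} t-prime t≈u ψ = trans (⇔→≡ (mk⇔ ○A⇒A A⇒○A)) (t≈u ψ)
    where
    ○A⇒A : ○ (A ψ) ∈ₜ t → A ψ ∈ₜ t
    ○A⇒A = ∈-mp t-prime (∈-⊩ t-prime (∧E₂ (axiom (allNxt ψ))))

    A⇒○A : A ψ ∈ₜ t → ○ (A ψ) ∈ₜ t
    A⇒○A = ∈-mp t-prime (∈-⊩ t-prime (∧E₁ (axiom (allNxt ψ))))

  record PrimeExtension (Φ Ψ : Pred Form 0ℓ) : Set where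
    field
      theory   : Theory
      isPrime  : IsPrime theory
      extends  : Φ ⊆ᵖ (_∈ₜ theory)
      avoids   : Ψ ⊆ᵖ ∁ (_∈ₜ theory)

  module Lindenbaum (lem : ExcludedMiddle 0ℓ) where

    record ConsistentPair : Set₁ where
      field
        left right : Pred Form 0ℓ
        consistent : ¬ left ⊩⋁ right

      Decides : Form → Set
      Decides χ = left χ ⊎ right χ

    open ConsistentPair

    record _≤ₚ_ (c d : ConsistentPair) : Set where
      field
        left⊆  : left c ⊆ᵖ left d
        right⊆ : right c ⊆ᵖ right d

    open _≤ₚ_

    ≤ₚ-refl : ∀ {c} → c ≤ₚ c
    ≤ₚ-refl = record { left⊆ = id ; right⊆ = id }

    ≤ₚ-trans : ∀ {c d e} → c ≤ₚ d → d ≤ₚ e → c ≤ₚ e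
    ≤ₚ-trans c≤d d≤e = record { left⊆ = left⊆ d≤e ∘ left⊆ c≤d ; right⊆ = right⊆ d≤e ∘ right⊆ c≤d }

    add : Form → ConsistentPair → ConsistentPair
    add χ c with lem {left c ∪ ｛ χ ｝ ⊩⋁ right c}
    ... | yes ⊩χ = record { left = left c ; right = right c ∪ ｛ χ ｝
                          ; consistent = λ ⊩Ψχ → consistent c (⊩⋁-cut ⊩Ψχ ⊩χ) }
    ... | no ⊮χ  = record { left = left c ∪ ｛ χ ｝ ; right = right c ; consistent = ⊮χ }

    add-≤ₚ : ∀ χ c → c ≤ₚ add χ c
    add-≤ₚ χ c with lem {left c ∪ ｛ χ ｝ ⊩⋁ right c}
    ... | yes _ = record { left⊆ = id ; right⊆ = inj₁ }
    ... | no _  = record { left⊆ = inj₁ ; right⊆ = id }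

    add-decides : ∀ χ c → Decides (add χ c) χ
    add-decides χ c with lem {left c ∪ ｛ χ ｝ ⊩⋁ right c}
    ... | yes _ = inj₂ (inj₂ refl)
    ... | no _  = inj₁ (inj₂ refl)

    addAll : List Form → ConsistentPair → ConsistentPair
    addAll []      c = c
    addAll (χ ∷ Γ) c = addAll Γ (add χ c)

    addAll-≤ₚ : ∀ Γ c → c ≤ₚ addAll Γ c
    addAll-≤ₚ []      c = ≤ₚ-refl
    addAll-≤ₚ (χ ∷ Γ) c = ≤ₚ-trans (add-≤ₚ χ c) (addAll-≤ₚ Γ (add χ c))

    addAll-decides : ∀ Γ c → χ ∈ Γ → Decides (addAll Γ c) χ
    addAll-decides (χ ∷ Γ) c (here refl) with addAll-≤ₚ Γ (add χ c) | add-decides χ c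
    ... | c≤ | inj₁ χ∈ = inj₁ (left⊆ c≤ χ∈)
    ... | c≤ | inj₂ χ∈ = inj₂ (right⊆ c≤ χ∈)
    addAll-decides (ψ ∷ Γ) c (there i) = addAll-decides Γ (add ψ c) i

    stage : ConsistentPair → ℕ → ConsistentPair
    stage c zero    = c
    stage c (suc n) = addAll (formulas n) (stage c n)

    stage-mono : ∀ c → m ≤ n → stage c m ≤ₚ stage c n
    stage-mono c = go ∘ ≤⇒≤′
      where
      go : m ≤′ n → stage c m ≤ₚ stage c n
      go (≤′-reflexive refl)  = ≤ₚ-refl
      go (≤′-step {n = n} p) = ≤ₚ-trans (go p) (addAll-≤ₚ (formulas n) (stage c n))

    All-bounded : {P : ℕ → Pred Form 0ℓ} → (∀ {m n} → m ≤ n → P m ⊆ᵖ P n) →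
                  All (λ χ → ∃ λ n → P n χ) Γ → ∃ λ n → All (P n) Γ
    All-bounded mono []             = 0 , []
    All-bounded mono ((m , p) ∷ ps) with n , ps′ ← All-bounded mono ps =
      m ⊔ n , mono (m≤m⊔n m n) p ∷ All.map (mono (m≤n⊔m m n)) ps′

    module Limit (c : ConsistentPair) where

      left∞ right∞ : Pred Form 0ℓ
      left∞  χ = ∃ λ n → left (stage c n) χ
      right∞ χ = ∃ λ n → right (stage c n) χ

      consistent∞ : ¬ left∞ ⊩⋁ right∞
      consistent∞ (Γ , Δ , Γ∈ , Δ∈ , d)
        with m , Γ∈ₘ ← All-bounded (left⊆ ∘ stage-mono c) Γ∈
           | n , Δ∈ₙ ← All-bounded (right⊆ ∘ stage-mono c) Δ∈ =
        consistent (stage c (m ⊔ n))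
          ( Γ , Δ , All.map (left⊆ (stage-mono c (m≤m⊔n m n))) Γ∈ₘ
          , All.map (right⊆ (stage-mono c (m≤n⊔m m n))) Δ∈ₙ , d)

      decides∞ : ∀ χ → left∞ χ ⊎ right∞ χ
      decides∞ χ with n , i ← formulas-cover χ
                 with addAll-decides (formulas n) (stage c n) i
      ... | inj₁ χ∈ = inj₁ (suc n , χ∈)
      ... | inj₂ χ∈ = inj₂ (suc n , χ∈)

      disjoint∞ : left∞ χ → right∞ χ → ⊥
      disjoint∞ {χ} χ∈l χ∈r = consistent∞ (χ ∷ [] , χ ∷ [] , χ∈l ∷ [] , χ∈r ∷ [] , ∨I₁ hyp₀)

    lindenbaum : ¬ Φ ⊩⋁ Ψ → PrimeExtension Φ Ψ
    lindenbaum {Φ} {Ψ} ⊮ = record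
      { theory  = theory
      ; isPrime = record
          { closed = theory-closed ; consistent = theory-consistent ; prime = theory-prime }
      ; extends = λ φ∈ → in-theory (0 , φ∈)
      ; avoids  = λ ψ∈ ψ∈t → disjoint∞ (out-theory ψ∈t) (0 , ψ∈)
      }
      where
      initial : ConsistentPair
      initial = record { left = Φ ; right = Ψ ; consistent = ⊮ }

      open Limit initial

      theory : Theory
      theory χ = isYes (lem {left∞ χ})

      in-theory : left∞ χ → χ ∈ₜ theory
      in-theory = Equivalence.to T-≡ ∘ fromWitness

      out-theory : χ ∈ₜ theory → left∞ χ
      out-theory = toWitness ∘ Equivalence.from T-≡

      theory-closed : All (_∈ₜ theory) Γ → Γ ⊩ φ → φ ∈ₜ theory
      theory-closed {Γ} {φ} Γ∈ d with decides∞ φ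
      ... | inj₁ φ∈ = in-theory φ∈
      ... | inj₂ φ∈ = ⊥-elim (consistent∞ (Γ , φ ∷ [] , All.map out-theory Γ∈ , φ∈ ∷ [] , ∨I₁ d))

      theory-consistent : ¬ (⊥' ∈ₜ theory)
      theory-consistent ⊥∈ = consistent∞ (⊥' ∷ [] , [] , out-theory ⊥∈ ∷ [] , [] , hyp₀)

      theory-prime : φ ∨' ψ ∈ₜ theory → φ ∈ₜ theory ⊎ ψ ∈ₜ theory
      theory-prime {φ} {ψ} ∨∈ with decides∞ φ | decides∞ ψ
      ... | inj₁ φ∈ | _       = inj₁ (in-theory φ∈)
      ... | inj₂ _  | inj₁ ψ∈ = inj₂ (in-theory ψ∈)
      ... | inj₂ φ∈ | inj₂ ψ∈ = ⊥-elim (consistent∞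
        (_ ∷ [] , φ ∷ ψ ∷ [] , out-theory ∨∈ ∷ [] , φ∈ ∷ ψ∈ ∷ [] , ∨E hyp₀ (∨I₁ hyp₀) (∨I₂ (∨I₁ hyp₀))))

  ⊩-FS : FischerServi L → Γ ++ map ○ Δ ⊩ ⋁ (map ○ Δ′) → Γ ⊩ ○ (⋀ Δ ⇒ ⋁ Δ′)
  ⊩-FS {Γ} {Δ} {Δ′} fischerServi d =
    app (thm (fischerServi _ _)) (lam (⋁E (map ○ Δ′) (⊩-subst ○⋀⊩ d) ○-⋁))
    where
    ○⋀⊩ : ψ ∈ Γ ++ map ○ Δ → ○ (⋀ Δ) ∷ Γ ⊩ ψ
    ○⋀⊩ i with ∈-++⁻ Γ i
    ... | inj₁ j = hyp (there j)
    ... | inj₂ j with φ , φ∈ , refl ← ∈-map⁻ ○ j = ○-mono (⋀E φ∈ hyp₀)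

    ○-⋁ : ψ ∈ map ○ Δ′ → ψ ∷ ○ (⋀ Δ) ∷ Γ ⊩ ○ (⋁ Δ′)
    ○-⋁ j with φ , φ∈ , refl ← ∈-map⁻ ○ j = ○-mono (⋁I φ∈ hyp₀)

  module Canonical (lem : ExcludedMiddle 0ℓ) (g : Theory) (g-prime : IsPrime g) where
    open Lindenbaum lem using (lindenbaum)
    open PrimeExtension

    -- state n is the theory of fⁿ w.
    record Orbit : Set where
      constructor orbit
      field
        state       : ℕ → Theory
        state-prime : ∀ n → IsPrime (state n)
        state-suc   : ∀ n χ → state (suc n) χ ≡ state n (○ χ)
        state-∀     : ∀ n → state n ≈∀ g

      head : Theory
      head = state 0

    open Orbit

    shift : Orbit → Orbit
    shift w = orbit (state w ∘ suc) (state-prime w ∘ suc) (state-suc w ∘ suc) (state-∀ w ∘ suc)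

    orbitFrom : ∀ t → IsPrime t → t ≈∀ g → Orbit
    orbitFrom t t-prime t≈g = orbit (fold t next) fold-prime (λ _ _ → refl) fold-≈∀
      where
      fold-prime : ∀ n → IsPrime (fold t next n)
      fold-prime zero    = t-prime
      fold-prime (suc n) = next-prime (fold-prime n)

      fold-≈∀ : ∀ n → fold t next n ≈∀ g
      fold-≈∀ zero    = t≈g
      fold-≈∀ (suc n) = next-≈∀ {u = g} (fold-prime n) (fold-≈∀ n)

    prepend : ∀ t → IsPrime t → t ≈∀ g → (v : Orbit) → (∀ χ → head v χ ≡ t (○ χ)) → Orbit
    prepend t t-prime t≈g v v≡next = orbit
      (λ { zero → t       ; (suc n) → state v n })
      (λ { zero → t-prime ; (suc n) → state-prime v n })
      (λ { zero → v≡next  ; (suc n) → state-suc v n })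
      (λ { zero → t≈g     ; (suc n) → state-∀ v n })

    infix 4 _⊑_
    _⊑_ : Orbit → Orbit → Set
    w ⊑ v = head w ⊆ₜ head v

    shift-mono : ∀ {w v} → w ⊑ v → shift w ⊑ shift v
    shift-mono {w} {v} w⊑v {χ} χ∈ = trans (state-suc v 0 χ) (w⊑v (trans (sym (state-suc w 0 χ)) χ∈))

    ≈∀-above : ∀ w {t} → IsPrime t → head w ⊆ₜ t → t ≈∀ g
    ≈∀-above w t-prime w⊆t ψ = trans (≈∀-⊆ (state-prime w 0) t-prime w⊆t ψ) (state-∀ w 0 ψ)

    ⇒-witness : ∀ w → ¬ (φ ⇒ ψ ∈ₜ head w) → ∃ λ x → w ⊑ x × φ ∈ₜ head x × ¬ (ψ ∈ₜ head x)
    ⇒-witness {φ} {ψ} w φ⇒ψ∉ =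
      orbitFrom (theory e) (isPrime e) (≈∀-above w (isPrime e) (extends e ∘ inj₁)) ,
      extends e ∘ inj₁ , extends e (inj₂ refl) , avoids e refl
      where
      ⊮ψ : ¬ (_∈ₜ head w) ∪ ｛ φ ｝ ⊩⋁ ｛ ψ ｝
      ⊮ψ ⊩ψ with Γ , Γ∈ , d ← ⊩⋁-｛｝ ⊩ψ with Γ′ , Γ′∈ , Γ⊆ ← All-∪｛｝ Γ∈ =
        φ⇒ψ∉ (closed (state-prime w 0) Γ′∈ (lam (⊩-weaken Γ⊆ d)))

      e : PrimeExtension ((_∈ₜ head w) ∪ ｛ φ ｝) ｛ ψ ｝
      e = lindenbaum ⊮ψ

    ∀-witness : ¬ (A φ ∈ₜ g) → ∃ λ x → ¬ (φ ∈ₜ head x)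
    ∀-witness {φ} Aφ∉ = orbitFrom (theory e) (isPrime e) ≈g , avoids e refl
      where
      -- These can be necessitated, and they include all ∀-literals of g.
      StableIn-g : Pred Form 0ℓ
      StableIn-g χ = χ ∈ₜ g × Stable χ

      ⊮φ : ¬ StableIn-g ⊩⋁ ｛ φ ｝
      ⊮φ ⊩φ with Γ , Γ∈ , d ← ⊩⋁-｛｝ ⊩φ =
        Aφ∉ (closed g-prime (All.map proj₁ Γ∈) (⊩-nec∀ (All.map proj₂ Γ∈) d))

      e : PrimeExtension StableIn-g ｛ φ ｝
      e = lindenbaum ⊮φ

      ≈g : theory e ≈∀ g
      ≈g = ≈∀-of-literals g-prime (isPrime e)
             (λ A∈ → extends e (A∈ , A-stable)) (λ ¬A∈ → extends e (¬A∈ , ¬A-stable))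

    -- Ordering orbits by inclusion of their heads is not antisymmetric with respect
    -- to _≡_; unravelling them into paths is, since each step of _≼_ increases depth.
    infixr 5 _◂_
    data Path : Set where
      root : Orbit → Path
      _◂_  : Orbit → Path → Path

    tip : Path → Orbit
    tip (root x) = x
    tip (x ◂ p)  = x

    depth : Path → ℕ
    depth (root x) = 0
    depth (x ◂ p)  = suc (depth p)

    at : Path → Theory
    at p = head (tip p)

    at-prime : ∀ p → IsPrime (at p)
    at-prime p = state-prime (tip p) 0

    infix 4 _≼_
    data _≼_ : Path → Path → Set where
      ≼-refl : ∀ {p} → p ≼ p
      ≼-step : ∀ {p q x} → p ≼ q → tip q ⊑ x → p ≼ x ◂ q

    ≼-trans : ∀ {p q r} → p ≼ q → q ≼ r → p ≼ r
    ≼-trans p≼q ≼-refl          = p≼q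
    ≼-trans p≼q (≼-step q≼r r⊑) = ≼-step (≼-trans p≼q q≼r) r⊑

    ≼-depth : ∀ {p q} → p ≼ q → depth p ≤ depth q
    ≼-depth ≼-refl         = ≤-refl
    ≼-depth (≼-step p≼q _) = ≤-trans (≼-depth p≼q) (n≤1+n _)

    ≼-antisym : ∀ {p q} → p ≼ q → q ≼ p → p ≡ q
    ≼-antisym ≼-refl         _   = refl
    ≼-antisym (≼-step p≼q _) q≼p = ⊥-elim (<-irrefl refl (≤-trans (≼-depth q≼p) (≼-depth p≼q)))

    ≼-⊆ : ∀ {p q} → p ≼ q → at p ⊆ₜ at q
    ≼-⊆ ≼-refl          = id
    ≼-⊆ (≼-step p≼q q⊑) = q⊑ ∘ ≼-⊆ p≼q

    shiftPath : Path → Path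
    shiftPath (root x) = root (shift x)
    shiftPath (x ◂ p)  = shift x ◂ shiftPath p

    tip-shiftPath : ∀ p → tip (shiftPath p) ≡ shift (tip p)
    tip-shiftPath (root x) = refl
    tip-shiftPath (x ◂ p)  = refl

    at-shiftPath : ∀ p → ∀ χ → at (shiftPath p) χ ≡ at p (○ χ)
    at-shiftPath (root x) = state-suc x 0
    at-shiftPath (x ◂ p)  = state-suc x 0

    shiftPath-mono : ∀ {p q} → p ≼ q → shiftPath p ≼ shiftPath q
    shiftPath-mono ≼-refl = ≼-refl
    shiftPath-mono (≼-step {q = q} {x} p≼q q⊑x) =
      ≼-step (shiftPath-mono p≼q)
             (subst (_⊑ shift x) (sym (tip-shiftPath q)) (shift-mono {tip q} {x} q⊑x))

    canonical : ExpandingPoset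
    canonical = record
      { W              = Path
      ; _≼_            = _≼_
      ; isPartialOrder = record
          { isPreorder = record
              { isEquivalence = isEquivalence
              ; reflexive     = λ { refl → ≼-refl }
              ; trans         = ≼-trans
              }
          ; antisym = ≼-antisym
          }
      ; f        = shiftPath
      ; monotone = shiftPath-mono
      }

    ν : Valuation canonical
    ν = record { V = λ n p → var n ∈ₜ at p ; V-open = λ n p≼q → ≼-⊆ p≼q }

    infix 4 _⊨_
    _⊨_ : Path → Form → Set
    p ⊨ φ = ⟦_⟧ canonical φ ν p

    truth⁺ : ∀ φ p → p ⊨ φ → φ ∈ₜ at p
    truth⁻ : ∀ φ p → φ ∈ₜ at p → p ⊨ φ

    truth⁺ (var n)  p ⊨φ       = ⊨φ
    truth⁺ (φ ∧' ψ) p (⊨φ , ⊨ψ) =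
      closed (at-prime p) (truth⁺ φ p ⊨φ ∷ truth⁺ ψ p ⊨ψ ∷ []) (∧I hyp₀ hyp₁)
    truth⁺ (φ ∨' ψ) p (inj₁ ⊨φ) = closed (at-prime p) (truth⁺ φ p ⊨φ ∷ []) (∨I₁ hyp₀)
    truth⁺ (φ ∨' ψ) p (inj₂ ⊨ψ) = closed (at-prime p) (truth⁺ ψ p ⊨ψ ∷ []) (∨I₂ hyp₀)
    truth⁺ (○ φ)    p ⊨φ       = trans (sym (at-shiftPath p φ)) (truth⁺ φ (shiftPath p) ⊨φ)
    truth⁺ (φ ⇒ ψ)  p ⊨φ⇒ψ with at p (φ ⇒ ψ) ≟ true
    ... | yes φ⇒ψ∈ = φ⇒ψ∈
    ... | no φ⇒ψ∉ with x , p⊑x , φ∈ , ψ∉ ← ⇒-witness (tip p) φ⇒ψ∉ =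
      ⊥-elim (ψ∉ (truth⁺ ψ (x ◂ p) (⊨φ⇒ψ (x ◂ p) (≼-step ≼-refl p⊑x) (truth⁻ φ (x ◂ p) φ∈))))
    truth⁺ (A φ)    p ⊨Aφ with at p (A φ) ≟ true
    ... | yes Aφ∈ = Aφ∈
    ... | no Aφ∉ with x , φ∉ ← ∀-witness (Aφ∉ ∘ trans (state-∀ (tip p) 0 φ)) =
      ⊥-elim (φ∉ (truth⁺ φ (root x) (⊨Aφ (root x))))

    truth⁻ ⊥'       p ⊥∈   = consistent (at-prime p) ⊥∈
    truth⁻ (var n)  p var∈ = var∈
    truth⁻ (φ ∧' ψ) p ∧∈   = truth⁻ φ p (closed (at-prime p) (∧∈ ∷ []) (∧E₁ hyp₀))
                           , truth⁻ ψ p (closed (at-prime p) (∧∈ ∷ []) (∧E₂ hyp₀))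
    truth⁻ (φ ∨' ψ) p ∨∈   = [ inj₁ ∘ truth⁻ φ p , inj₂ ∘ truth⁻ ψ p ] (prime (at-prime p) ∨∈)
    truth⁻ (φ ⇒ ψ)  p ⇒∈ q p≼q ⊨φ = truth⁻ ψ q (∈-mp (at-prime q) (≼-⊆ p≼q ⇒∈) (truth⁺ φ q ⊨φ))
    truth⁻ (○ φ)    p ○∈   = truth⁻ φ (shiftPath p) (trans (at-shiftPath p φ) ○∈)
    truth⁻ (A φ)    p A∈ q = truth⁻ φ q (∈-mp (at-prime q) (∈-⊩ (at-prime q) (axiom (allT φ))) A∈q)
      where
      A∈q : A φ ∈ₜ at q
      A∈q = trans (state-∀ (tip q) 0 φ) (trans (sym (state-∀ (tip p) 0 φ)) A∈)

    module Persistence (fischerServi : FischerServi L) where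

      shift-persistent : ∀ w v → shift w ⊑ v → ∃ λ w′ → w ⊑ w′ × shift w′ ≡ v
      shift-persistent w v shift⊑v =
        prepend (theory e) (isPrime e) ≈g v v≡next , extends e ∘ inj₁ , refl
        where
        w-prime : IsPrime (head w)
        w-prime = state-prime w 0

        v-prime : IsPrime (head v)
        v-prime = state-prime v 0

        ⊮ : ¬ (_∈ₜ head w) ∪ ○[ _∈ₜ head v ] ⊩⋁ ○[ ∁ (_∈ₜ head v) ]
        ⊮ (Γ , _ , Γ∈ , Δ∈ , d)
          with Γ₁ , Γ₂ , Γ₁∈ , Γ₂∈ , Γ⊆ ← All-∪ Γ∈
          with Cs , Cs∈ , refl ← All-○[] Γ₂∈
             | Ds , Ds∉ , refl ← All-○[] Δ∈ =
          let ⋀⇒⋁∈ = shift⊑v (trans (state-suc w 0 _)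
                                     (closed w-prime Γ₁∈ (⊩-FS fischerServi (⊩-weaken Γ⊆ d))))
              ⋀Cs∈ = closed v-prime Cs∈ (⋀I Cs hyp)
              φ , φ∈Ds , φ∈v = ⋁-prime v-prime Ds (∈-mp v-prime ⋀⇒⋁∈ ⋀Cs∈)
          in All.lookup Ds∉ φ∈Ds φ∈v

        e : PrimeExtension ((_∈ₜ head w) ∪ ○[ _∈ₜ head v ]) ○[ ∁ (_∈ₜ head v) ]
        e = lindenbaum ⊮

        ≈g : theory e ≈∀ g
        ≈g = ≈∀-above w (isPrime e) (extends e ∘ inj₁)

        reflect : ○ χ ∈ₜ theory e → χ ∈ₜ head v
        reflect {χ} ○χ∈ with head v χ ≟ true
        ... | yes χ∈ = χ∈
        ... | no χ∉  = ⊥-elim (avoids e (χ , refl , χ∉) ○χ∈)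

        v≡next : ∀ χ → head v χ ≡ theory e (○ χ)
        v≡next χ = ⇔→≡ (mk⇔ (λ χ∈ → extends e (inj₂ (χ , refl , χ∈))) reflect)

      shiftPath-persistent : ∀ p q → shiftPath p ≼ q → ∃ λ p′ → p ≼ p′ × shiftPath p′ ≡ q
      shiftPath-persistent p _ ≼-refl = p , ≼-refl , refl
      shiftPath-persistent p _ (≼-step {q = q} {x} shiftp≼q q⊑x)
        with p′ , p≼p′ , refl ← shiftPath-persistent p q shiftp≼q
        with w′ , tip⊑w′ , refl ←
               shift-persistent (tip p′) x (subst (_⊑ x) (tip-shiftPath p′) q⊑x) =
        w′ ◂ p′ , ≼-step p≼p′ tip⊑w′ , refl

      canonical-persistent : PersistentPoset
      canonical-persistent = record { expanding = canonical ; persistent = shiftPath-persistent }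

  module Countermodel (lem : ExcludedMiddle 0ℓ) {φ} (⊬φ : ¬ ⊢ φ) where
    open Lindenbaum lem using (lindenbaum)
    open PrimeExtension

    ∅⊮φ : ¬ ∅ ⊩⋁ ｛ φ ｝
    ∅⊮φ ⊩φ with Γ , Γ∈ , d ← ⊩⋁-｛｝ ⊩φ = ⊬φ (⊩⇒⊢ (⊩-subst (⊥-elim ∘ All.lookup Γ∈) d))

    e : PrimeExtension ∅ ｛ φ ｝
    e = lindenbaum ∅⊮φ

    open Canonical lem (theory e) (isPrime e) public

    point : Path
    point = root (orbitFrom (theory e) (isPrime e) (λ _ → refl))

    point⊭φ : ¬ point ⊨ φ
    point⊭φ ⊨φ = avoids e refl (truth⁺ φ point ⊨φ)

    ¬valid-expanding : ¬ ValidExpanding φ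
    ¬valid-expanding valid = point⊭φ (valid canonical ν point)

    ¬valid-persistent : FischerServi L → ¬ ValidPersistent φ
    ¬valid-persistent fischerServi valid =
      point⊭φ (valid (Persistence.canonical-persistent fischerServi) ν point)

  complete-expanding : ExcludedMiddle 0ℓ → ∀ φ → ValidExpanding φ → ⊢ φ
  complete-expanding lem φ valid with lem {⊢ φ}
  ... | yes ⊢φ = ⊢φ
  ... | no ⊬φ  = ⊥-elim (Countermodel.¬valid-expanding lem ⊬φ valid)

  complete-persistent : ExcludedMiddle 0ℓ → FischerServi L → ∀ φ → ValidPersistent φ → ⊢ φ
  complete-persistent lem fischerServi φ valid with lem {⊢ φ}
  ... | yes ⊢φ = ⊢φ
  ... | no ⊬φ  = ⊥-elim (Countermodel.¬valid-persistent lem ⊬φ fischerServi valid)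

theorem9p4 : ExcludedMiddle Level.zero →
    ((φ : Form) → ValidExpanding φ → ⊢⁰ φ) × ((φ : Form) → ValidPersistent φ → ⊢FS φ)
theorem9p4 lem = complete-expanding ITL⁰ lem , complete-persistent ITLFS lem ITLFS-FischerServi
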